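{- Let $T$ be a basic tournament with $V(T)=\{v_1,\ldots,v_n\}$, and let $T^*=T(H_1,\ldots,H_n)$ be the blowup of $T$ with respect to tournaments $H_1,\ldots,H_n$, where for some $i$, $H_i$ is a $3$-cycle and $|V(H_j)|=1$ for every $j\ne i$. Then $T^*$ is a basic tournament.
   Context: A tournament is a digraph with exactly one arc between each pair of distinct vertices. For distinct vertices write $\theta_T(u,v)=1$ if $u\to v$, $-1$ otherwise. Two vertices $w_1,w_2$ of a tournament $R$ with $|V(R)|\ge3$ are covertices if $\theta_R(w_1,v)=\theta_R(w_2,v)$ for all other $v$, revertices if $\theta_R(w_1,v)=-\theta_R(w_2,v)$ for all other $v$, CR-associated if either. A tournament of order at least 4 is basic if no two of its vertices are CR-associated. Blowup: for $T$ with vertices $v_1,\dots,v_n$ and tournaments $H_1,\dots,H_n$, $T(H_1,\dots,H_n)$ is obtained by replacing each $v_i$ by $H_i$ and putting all arcs from $V(H_i)$ to $V(H_j)$ whenever $v_i\to v_j$. -}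

module Defs where

open import Data.Nat using (ℕ)
open import Data.Fin using (Fin)
open import Data.Bool using (Bool; true; false; not)
open import Data.Product using (Σ; _,_; _×_; proj₁; proj₂)
open import Data.Sum using (_⊎_)
open import Relation.Binary.PropositionalEquality using (_≡_; _≢_)
open import Relation.Nullary using (¬_)
open import Function.Definitions using (Injective)

record Tournament (V : Set) : Set where
  field
    arc        : V → V → Bool
    irrefl     : ∀ v → arc v v ≡ false
    tournament : ∀ u v → u ≢ v → arc v u ≡ not (arc u v)
open Tournament public

-- θ_T(u,v) = 1 if u → v, −1 otherwise; we encode ±1 by Bool (true ↔ 1, false ↔ −1).
θ : ∀ {V} → Tournament V → V → V → Bool
θ T u v = arc T u v

AtLeast : ℕ → Set → Set
AtLeast k V = Σ (Fin k → V) (λ f → Injective _≡_ _≡_ f)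

Covertices : ∀ {V} → Tournament V → V → V → Set
Covertices T w₁ w₂ = ∀ v → v ≢ w₁ → v ≢ w₂ → θ T w₁ v ≡ θ T w₂ v

Revertices : ∀ {V} → Tournament V → V → V → Set
Revertices T w₁ w₂ = ∀ v → v ≢ w₁ → v ≢ w₂ → θ T w₁ v ≡ not (θ T w₂ v)

CRAssociated : ∀ {V} → Tournament V → V → V → Set
CRAssociated T w₁ w₂ = Covertices T w₁ w₂ ⊎ Revertices T w₁ w₂

-- Basic: order at least 4 and no two distinct vertices are CR-associated.
-- (Covertices/revertices are defined for tournaments of order ≥ 3, implied by order ≥ 4.)
Basic : ∀ {V} → Tournament V → Set
Basic {V} T = AtLeast 4 V × (∀ w₁ w₂ → w₁ ≢ w₂ → ¬ CRAssociated T w₁ w₂)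

module _ {n : ℕ} where
  open import Data.Fin using (_≟_)
  open import Relation.Nullary using (yes; no)
  open import Relation.Binary.PropositionalEquality using (refl; subst; cong; sym)
  open import Data.Fin.Properties using () renaming (_≟_ to _≟F_)

  blowupArc : (T : Tournament (Fin n)) (m : Fin n → ℕ) (H : (i : Fin n) → Tournament (Fin (m i)))
            → Σ (Fin n) (λ i → Fin (m i)) → Σ (Fin n) (λ i → Fin (m i)) → Bool
  blowupArc T m H (i , x) (j , y) with i ≟ j
  ... | yes refl = arc (H i) x y
  ... | no _     = arc T i j

  private
    irr : (T : Tournament (Fin n)) (m : Fin n → ℕ) (H : (i : Fin n) → Tournament (Fin (m i)))
        → ∀ v → blowupArc T m H v v ≡ false
    irr T m H (i , x) with i ≟ i
    ... | yes refl = irrefl (H i) x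
    ... | no i≢i   = Data.Empty.⊥-elim (i≢i refl)
      where import Data.Empty

    tour : (T : Tournament (Fin n)) (m : Fin n → ℕ) (H : (i : Fin n) → Tournament (Fin (m i)))
         → ∀ u v → u ≢ v → blowupArc T m H v u ≡ not (blowupArc T m H u v)
    tour T m H (i , x) (j , y) u≢v with i ≟ j | j ≟ i
    ... | yes refl | yes refl = tournament (H i) x y (λ x≡y → u≢v (cong (i ,_) x≡y))
    ... | yes refl | no j≢i   = Data.Empty.⊥-elim (j≢i refl)
      where import Data.Empty
    ... | no i≢j   | yes refl = Data.Empty.⊥-elim (i≢j refl)
      where import Data.Empty
    ... | no i≢j   | no _     = tournament T i j i≢j

  Blowup : (T : Tournament (Fin n)) (m : Fin n → ℕ) (H : (i : Fin n) → Tournament (Fin (m i)))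
         → Tournament (Σ (Fin n) (λ i → Fin (m i)))
  Blowup T m H = record { arc = blowupArc T m H ; irrefl = irr T m H ; tournament = tour T m H }

IsThreeCycle : ∀ {V} → Tournament V → Set
IsThreeCycle {V} H = Σ V λ a → Σ V λ b → Σ V λ c →
  (∀ v → v ≡ a ⊎ (v ≡ b ⊎ v ≡ c)) ×
  (a ≢ b × (b ≢ c × a ≢ c)) ×
  (arc H a b ≡ true × (arc H b c ≡ true × arc H c a ≡ true))

{-# OPTIONS --safe #-}
module Submission where

-- Two vertices in different blocks of the blowup are CR-associated only if
-- their blocks are, as one sees by testing them against one representative
-- of every block; this is excluded since T is basic.  Two vertices of a
-- singleton block coincide.  Two vertices of the 3-cycle block are not
-- revertices, because they see any vertex outside the block the same way, and
-- not covertices, because the third vertex of the 3-cycle separates them.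

open import Defs
open import Data.Nat using (ℕ; _+_)
open import Data.Fin using (Fin; zero; suc; _≟_)
open import Data.Fin.Properties using (0≢1+n)
open import Data.Bool using (Bool; true; false; not)
open import Data.Bool.Properties using (not-¬)
open import Data.Product using (Σ; ∃; _,_; proj₁)
open import Data.Sum using (_⊎_; inj₁; inj₂; [_,_])
import Data.Sum as Sum
open import Function using (_∘_; id)
open import Relation.Nullary using (¬_; yes; no; contradiction)
open import Relation.Binary.Definitions using (DecidableEquality)
open import Relation.Binary.PropositionalEquality
  using (_≡_; _≢_; refl; sym; trans; cong; subst; ≢-sym; module ≡-Reasoning)

private
  variable
    V : Set

AtLeast-Σ : {P : V → Set} {k : ℕ} → ((v : V) → P v) → AtLeast k V → AtLeast k (Σ V P)
AtLeast-Σ s (f , f-inj) = (λ l → f l , s (f l)) , f-inj ∘ cong proj₁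

AtLeast2⇒∃≢ : {k : ℕ} → DecidableEquality V → AtLeast (2 + k) V → (v : V) → ∃ λ u → u ≢ v
AtLeast2⇒∃≢ _≟V_ (f , f-inj) v with f zero ≟V v
... | no f₀≢v  = f zero , f₀≢v
... | yes f₀≡v = f (suc zero) , λ f₁≡v → 0≢1+n (f-inj (trans f₀≡v (sym f₁≡v)))

Fin1-irrelevant : {p : ℕ} → p ≡ 1 → (x y : Fin p) → x ≡ y
Fin1-irrelevant refl zero zero = refl

covertices-sym : {T : Tournament V} {x y : V} → Covertices T x y → Covertices T y x
covertices-sym cov v v≢y v≢x = sym (cov v v≢x v≢y)

module _ {T : Tournament V} where

  cycle-¬covertices : {u v w : V} → v ≢ w → w ≢ u →
                      arc T v w ≡ true → arc T w u ≡ true → ¬ Covertices T u v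
  cycle-¬covertices {u} {v} {w} v≢w w≢u vw wu cov with
    (begin
      false            ≡⟨ cong not wu ⟨
      not (arc T w u)  ≡⟨ tournament T w u w≢u ⟨
      arc T u w        ≡⟨ cov w w≢u (≢-sym v≢w) ⟩
      arc T v w        ≡⟨ vw ⟩
      true             ∎)
    where open ≡-Reasoning
  ... | ()

  threeCycle-¬covertices : IsThreeCycle T → {x y : V} → x ≢ y → ¬ Covertices T x y
  threeCycle-¬covertices (a , b , c , cover , (a≢b , b≢c , a≢c) , (ab , bc , ca)) {x} {y} x≢y =
    vertices (cover x) (cover y)
    where
    c≢a : c ≢ a
    c≢a = ≢-sym a≢c
    ¬ab : ¬ Covertices T a b
    ¬ab = cycle-¬covertices b≢c c≢a bc ca
    ¬bc : ¬ Covertices T b c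
    ¬bc = cycle-¬covertices c≢a a≢b ca ab
    ¬ca : ¬ Covertices T c a
    ¬ca = cycle-¬covertices a≢b b≢c ab bc
    vertices : x ≡ a ⊎ (x ≡ b ⊎ x ≡ c) → y ≡ a ⊎ (y ≡ b ⊎ y ≡ c) → ¬ Covertices T x y
    vertices (inj₁ refl)        (inj₁ refl)        = λ _ → x≢y refl
    vertices (inj₂ (inj₁ refl)) (inj₂ (inj₁ refl)) = λ _ → x≢y refl
    vertices (inj₂ (inj₂ refl)) (inj₂ (inj₂ refl)) = λ _ → x≢y refl
    vertices (inj₁ refl)        (inj₂ (inj₁ refl)) = ¬ab
    vertices (inj₂ (inj₁ refl)) (inj₂ (inj₂ refl)) = ¬bc
    vertices (inj₂ (inj₂ refl)) (inj₁ refl)        = ¬ca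
    vertices (inj₂ (inj₁ refl)) (inj₁ refl)        = ¬ab ∘ covertices-sym {T = T}
    vertices (inj₂ (inj₂ refl)) (inj₂ (inj₁ refl)) = ¬bc ∘ covertices-sym {T = T}
    vertices (inj₁ refl)        (inj₂ (inj₂ refl)) = ¬ca ∘ covertices-sym {T = T}

module _ {n : ℕ} (T : Tournament (Fin n)) (m : Fin n → ℕ) (H : (j : Fin n) → Tournament (Fin (m j))) where

  private
    B = Blowup T m H

  blowupArc-between : {j k : Fin n} (x : Fin (m j)) (y : Fin (m k)) → j ≢ k →
                      arc B (j , x) (k , y) ≡ arc T j k
  blowupArc-between {j} {k} x y j≢k with j ≟ k
  ... | yes j≡k = contradiction j≡k j≢k
  ... | no _    = refl

  blowupArc-within : {j : Fin n} (x y : Fin (m j)) → arc B (j , x) (j , y) ≡ arc (H j) x y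
  blowupArc-within {j} x y with j ≟ j
  ... | yes refl = refl
  ... | no j≢j   = contradiction refl j≢j

  CRAssociated-between : ((j : Fin n) → Fin (m j)) → {j k : Fin n} {x : Fin (m j)} {y : Fin (m k)} →
                         j ≢ k → CRAssociated B (j , x) (k , y) → CRAssociated T j k
  CRAssociated-between rep {j} {k} {x} {y} j≢k = Sum.map (descend id) (descend not)
    where
    descend : (f : Bool → Bool) →
              (∀ w → w ≢ (j , x) → w ≢ (k , y) → arc B (j , x) w ≡ f (arc B (k , y) w)) →
              (∀ v → v ≢ j → v ≢ k → arc T j v ≡ f (arc T k v))
    descend f related v v≢j v≢k
      rewrite sym (blowupArc-between x (rep v) (≢-sym v≢j))
            | sym (blowupArc-between y (rep v) (≢-sym v≢k)) =
      related (v , rep v) (v≢j ∘ cong proj₁) (v≢k ∘ cong proj₁)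

  ¬CRAssociated-within : {j l : Fin n} → l ≢ j → Fin (m l) → {x y : Fin (m j)} →
                         ¬ Covertices (H j) x y → ¬ CRAssociated B (j , x) (j , y)
  ¬CRAssociated-within {j} {l} l≢j z {x} {y} ¬cov = [ ¬cov ∘ covertices-within , ¬revertices ]
    where
    inBlock-≢ : {u v : Fin (m j)} → u ≢ v → (j , u) ≢ (j , v)
    inBlock-≢ u≢v refl = u≢v refl

    covertices-within : Covertices B (j , x) (j , y) → Covertices (H j) x y
    covertices-within cov v v≢x v≢y
      rewrite sym (blowupArc-within x v) | sym (blowupArc-within y v) =
      cov (j , v) (inBlock-≢ v≢x) (inBlock-≢ v≢y)

    ¬revertices : ¬ Revertices B (j , x) (j , y)
    ¬revertices rev = not-¬ sameArc (rev (l , z) (l≢j ∘ cong proj₁) (l≢j ∘ cong proj₁))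
      where
      sameArc : arc B (j , x) (l , z) ≡ arc B (j , y) (l , z)
      sameArc = trans (blowupArc-between x z (≢-sym l≢j)) (sym (blowupArc-between y z (≢-sym l≢j)))

proposition3p13 : (n : ℕ) (T : Tournament (Fin n)) → Basic T →
    (m : Fin n → ℕ) (H : (i : Fin n) → Tournament (Fin (m i))) (i : Fin n) →
    IsThreeCycle (H i) → (∀ j → j ≢ i → m j ≡ 1) →
    Basic (Blowup T m H)
proposition3p13 n T (order≥4 , T-basic) m H i cycle singleton =
  AtLeast-Σ rep order≥4 , noCRAssociated
  where
  rep : (j : Fin n) → Fin (m j)
  rep j with j ≟ i
  ... | yes refl = proj₁ cycle
  ... | no j≢i   = subst Fin (sym (singleton j j≢i)) zero

  noCRAssociated : ∀ w₁ w₂ → w₁ ≢ w₂ → ¬ CRAssociated (Blowup T m H) w₁ w₂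
  noCRAssociated (j , x) (k , y) w₁≢w₂ with j ≟ k
  ... | no j≢k = T-basic j k j≢k ∘ CRAssociated-between T m H rep j≢k
  ... | yes refl with j ≟ i
  ...   | no j≢i   = contradiction (cong (j ,_) (Fin1-irrelevant (singleton j j≢i) x y)) w₁≢w₂
  ...   | yes refl with AtLeast2⇒∃≢ {k = 2} _≟_ order≥4 i
  ...     | l , l≢i = ¬CRAssociated-within T m H l≢i (rep l)
                        (threeCycle-¬covertices {T = H i} cycle (w₁≢w₂ ∘ cong (i ,_)))
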